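{- Let $G$ be a non-bipartite quadrangulation of $\mathbb{P}^2$ and $S$ an odd support set of $G$. Then there is an odd support set $S'$ whose vertices all belong to $S$, with order at most the order of $S$, such that the vertices of $S'$ are pairwise distinct and two vertices of $S'$ are adjacent or opposite in $G$ if and only if they are consecutive in $S'$.
   Context: A quadrangulation of the real projective plane $\mathbb{P}^2$ is a graph embedded in $\mathbb{P}^2$ so that every face is bounded by four edges; non-bipartite means the graph is not bipartite. For such $G=(V,E)$, a support set is a circularly ordered sequence of vertices of $V$ (repetitions allowed) such that any two consecutive vertices lie on a common face of $G$. Two distinct vertices lying on a common face that are not adjacent have a common neighbor on that face and are called opposite. The order of a support set is the number of pairs of consecutive vertices that are adjacent in $G$; the support set is odd if its order is odd. -}

module Defs where

open import Data.Nat using (ℕ; zero; suc; _+_; _%_; _≤_)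
open import Data.Fin using (Fin; toℕ)
open import Data.Fin.Properties using (any?; _≟_)
open import Data.Bool using (Bool)
open import Data.Empty using (⊥)
open import Data.List using (List; []; _∷_; _++_; [_]; zip; length; filter)
open import Data.List.Membership.Propositional using (_∈_)
open import Data.List.Relation.Unary.All using (All)
open import Data.Product using (Σ; ∃; ∃-syntax; _×_; _,_; proj₁; proj₂)
open import Data.Sum using (_⊎_)
open import Relation.Nullary using (¬_; Dec)
open import Relation.Nullary.Decidable using (_×-dec_)
open import Relation.Binary.PropositionalEquality using (_≡_; _≢_)
open import Function using (_∘_; _⇔_)

iter : ∀ {A : Set} → ℕ → (A → A) → A → A
iter zero    f x = x
iter (suc k) f x = f (iter k f x)

data Reach {m : ℕ} (gens : List (Fin m → Fin m)) (x : Fin m) : Fin m → Set where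
  here : Reach gens x x
  step : ∀ {y f} → Reach gens x y → f ∈ gens → Reach gens x (f y)

-- A quadrangulation of the real projective plane, given combinatorially as a
-- generalized map (flag system) on m flags with involutions α₀ α₁ α₂:
--  * vertices  = orbits of ⟨α₁,α₂⟩  (indexed by Fin nv via `vert`),
--  * edges     = orbits of ⟨α₀,α₂⟩  (indexed by Fin ne via `edge`),
--  * faces     = orbits of ⟨α₀,α₁⟩  (indexed by Fin nf via `face`).
-- The underlying closed surface is connected with Euler characteristic
-- nv - ne + nf = 1, hence it is the projective plane.
-- Every face has boundary walk of length 4: α₁α₀ acts with order exactly 4.
record QuadP2 : Set where
  field
    m nv ne nf : ℕ
    α₀ α₁ α₂ : Fin m → Fin m
    α₀-inv : ∀ x → α₀ (α₀ x) ≡ x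
    α₁-inv : ∀ x → α₁ (α₁ x) ≡ x
    α₂-inv : ∀ x → α₂ (α₂ x) ≡ x
    α₀-fpf : ∀ x → α₀ x ≢ x
    α₁-fpf : ∀ x → α₁ x ≢ x
    α₂-fpf : ∀ x → α₂ x ≢ x
    α₀α₂-comm : ∀ x → α₀ (α₂ x) ≡ α₂ (α₀ x)
    α₀α₂-fpf : ∀ x → α₀ (α₂ x) ≢ x
    vert : Fin m → Fin nv
    edge : Fin m → Fin ne
    face : Fin m → Fin nf
    vert-surj : ∀ v → ∃[ x ] vert x ≡ v
    edge-surj : ∀ e → ∃[ x ] edge x ≡ e
    face-surj : ∀ f → ∃[ x ] face x ≡ f
    vert-orbit : ∀ x y → (vert x ≡ vert y) ⇔ Reach (α₁ ∷ α₂ ∷ []) x y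
    edge-orbit : ∀ x y → (edge x ≡ edge y) ⇔ Reach (α₀ ∷ α₂ ∷ []) x y
    face-orbit : ∀ x y → (face x ≡ face y) ⇔ Reach (α₀ ∷ α₁ ∷ []) x y
    connected : ∀ x y → Reach (α₀ ∷ α₁ ∷ α₂ ∷ []) x y
    euler : nv + nf ≡ ne + 1
    quad : ∀ x → iter 4 (α₁ ∘ α₀) x ≡ x
    quad-not2 : ∀ x → iter 2 (α₁ ∘ α₀) x ≢ x

module _ (G : QuadP2) where
  open QuadP2 G

  V : Set
  V = Fin nv

  Adj : V → V → Set
  Adj u w = ∃[ x ] (vert x ≡ u × vert (α₀ x) ≡ w)

  adj? : ∀ u w → Dec (Adj u w)
  adj? u w = any? (λ x → (vert x ≟ u) ×-dec (vert (α₀ x) ≟ w))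

  CommonFace : V → V → Set
  CommonFace u w = ∃[ x ] ∃[ y ] (face x ≡ face y × vert x ≡ u × vert y ≡ w)

  Opposite : V → V → Set
  Opposite u w = u ≢ w × CommonFace u w × ¬ Adj u w

  NonBipartite : Set
  NonBipartite = ¬ (Σ (V → Bool) λ c → ∀ u w → Adj u w → c u ≢ c w)

  cyclicPairs : List V → List (V × V)
  cyclicPairs []       = []
  cyclicPairs (x ∷ xs) = zip (x ∷ xs) (xs ++ [ x ])

  IsSupportSet : List V → Set
  IsSupportSet S = All (λ p → CommonFace (proj₁ p) (proj₂ p)) (cyclicPairs S)

  order : List V → ℕ
  order S = length (filter (λ p → adj? (proj₁ p) (proj₂ p)) (cyclicPairs S))

  Odd : ℕ → Set
  Odd k = k % 2 ≡ 1

  Consecutive : (k : ℕ) → Fin k → Fin k → Set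
  Consecutive zero    i j = ⊥
  Consecutive (suc n) i j = toℕ j ≡ suc (toℕ i) % suc n ⊎ toℕ i ≡ suc (toℕ j) % suc n

module Submission where

open import Defs
open import Data.Nat using (_≤_)
open import Data.Fin using (Fin)
open import Data.List using (List; length; lookup)
open import Data.List.Membership.Propositional using (_∈_)
open import Data.List.Relation.Unary.All using (All)
open import Data.List.Relation.Unary.Unique.Propositional using (Unique)
open import Data.Product using (Σ; _×_)
open import Data.Sum using (_⊎_)
open import Relation.Binary.PropositionalEquality using (_≢_)
open import Function using (_⇔_)

open import Data.Nat using (ℕ; zero; suc; _+_; _<_; _%_; z≤n; s≤s; s≤s⁻¹; s<s⁻¹; _≟_)
open import Data.Nat.Properties
  using (≤-refl; ≤-trans; ≤-reflexive; <-trans; ≤-<-trans; <-≤-trans; <-irrefl; <-cmp; n<1+n;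
         m≤m+n; m≤n+m; +-monoʳ-≤; +-monoˡ-≤; +-comm; +-suc; +-identityʳ; +-cancelˡ-≡;
         suc-injective; m≤n⇒m<n∨m≡n; n≤1⇒n≡0∨n≡1)
open import Data.Nat.DivMod using (m<n⇒m%n≡m; n%n≡0; %-distribˡ-+; m%n<n)
open import Data.Fin using (toℕ)
import Data.Fin.Properties as Fin
open import Data.List using ([]; _∷_; _++_; [_]; filter; zip)
open import Data.List.Properties using (length-++; ++-assoc; ++-identityʳ; ++-conicalˡ; ++-conicalʳ;
  filter-++; length-filter; tabulate-lookup)
import Data.List.Relation.Unary.All as All
import Data.List.Relation.Unary.Any as Any
import Data.List.Relation.Unary.All.Properties as All
open import Data.List.Relation.Unary.AllPairs.Properties using (tabulate⁺)
open import Data.List.Relation.Binary.Subset.Propositional using (_⊆_)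
open import Data.List.Relation.Binary.Subset.Propositional.Properties
  using (∷⁺ʳ; ++⁺ʳ; xs⊆xs++ys; xs⊆ys++xs; ⊆-respʳ-↭)
open import Data.List.Relation.Binary.Permutation.Propositional using (_↭_; ↭-sym; ↭-reflexive; ↭-trans)
open import Data.List.Relation.Binary.Permutation.Propositional.Properties
  using (All-resp-↭; filter-↭; ↭-length; ++-comm)
open import Data.Product using (_,_; proj₁; proj₂)
open import Data.Sum using (inj₁; inj₂)
import Data.Sum as Sum
open import Data.Sum.Function.Propositional using (_⊎-⇔_)
open import Data.Empty using (⊥-elim)
open import Relation.Nullary using (¬_; Dec; yes; no; ¬?)
open import Relation.Nullary.Decidable using (_×-dec_; _⊎-dec_)
open import Relation.Binary.PropositionalEquality using (_≡_; refl; sym; trans; cong; cong₂; subst; subst₂)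
open import Relation.Binary.Definitions using (tri<; tri≈; tri>)
open import Function using (_∘_; id; mk⇔; Equivalence)
open import Function.Properties.Equivalence using () renaming (trans to ⇔-trans)

-- Call a pair of distinct positions i, j of a support set S a shortcut if they
-- carry the same vertex, or if they are not consecutive but their vertices
-- share a face.  Cutting S at a shortcut splits the circular sequence into two
-- arcs.  For a repeated vertex each arc is itself a closed support set; for a
-- face-sharing pair u, w each arc closed up by the pair (u, w) is one.  The
-- orders of the two pieces add up to the order of S, plus twice the weight
-- (0 or 1) of the closing pair, so by parity one piece is odd, of order at most
-- that of S, and strictly shorter.  Iterating (induction on the length) ends
-- with a support set without shortcuts: its vertices are distinct, and two of
-- them are adjacent or opposite exactly when they are consecutive.

parity : ∀ a → a % 2 ≡ 0 ⊎ a % 2 ≡ 1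
parity a with a % 2 | m%n<n a 2
... | 0 | _ = inj₁ refl
... | 1 | _ = inj₂ refl
... | suc (suc _) | s≤s (s≤s ())

odd-sum : ∀ a b → (a + b) % 2 ≡ 1 → (a % 2 ≡ 1 × b % 2 ≡ 0) ⊎ (a % 2 ≡ 0 × b % 2 ≡ 1)
odd-sum a b odd = bits (parity a) (parity b) (trans (sym (%-distribˡ-+ a b 2)) odd)
  where
  bits : ∀ {x y} → x ≡ 0 ⊎ x ≡ 1 → y ≡ 0 ⊎ y ≡ 1 → (x + y) % 2 ≡ 1 →
         (x ≡ 1 × y ≡ 0) ⊎ (x ≡ 0 × y ≡ 1)
  bits (inj₁ refl) (inj₁ refl) ()
  bits (inj₁ refl) (inj₂ refl) _ = inj₂ (refl , refl)
  bits (inj₂ refl) (inj₁ refl) _ = inj₁ (refl , refl)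
  bits (inj₂ refl) (inj₂ refl) ()

odd-summand : ∀ a b → (a + b) % 2 ≡ 1 → a % 2 ≡ 1 ⊎ b % 2 ≡ 1
odd-summand a b odd = Sum.map proj₁ proj₂ (odd-sum a b odd)

even+1 : ∀ a → a % 2 ≡ 0 → (a + 1) % 2 ≡ 1
even+1 a even = trans (%-distribˡ-+ a 1 2) (cong (λ r → (r + 1) % 2) even)

odd⇒positive : ∀ a → a % 2 ≡ 1 → 1 ≤ a
odd⇒positive (suc _) _ = s≤s z≤n

-- If a + b is odd and c ≤ 1 is added to both summands, one of a + c, b + c is
-- odd and at most a + b.  (a, b: orders of two arcs; c: weight of the chord.)
odd-choice : ∀ a b c → (a + b) % 2 ≡ 1 → c ≤ 1 →
  ((a + c) % 2 ≡ 1 × a + c ≤ a + b) ⊎ ((b + c) % 2 ≡ 1 × b + c ≤ a + b)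
odd-choice a b c odd c≤1 with n≤1⇒n≡0∨n≡1 c≤1 | odd-sum a b odd
... | inj₁ refl | inj₁ (oa , _) =
  inj₁ (subst (λ k → k % 2 ≡ 1) (sym (+-identityʳ a)) oa , +-monoʳ-≤ a z≤n)
... | inj₁ refl | inj₂ (_ , ob) =
  inj₂ (subst (λ k → k % 2 ≡ 1) (sym (+-identityʳ b)) ob ,
        ≤-trans (≤-reflexive (+-identityʳ b)) (m≤n+m b a))
... | inj₂ refl | inj₁ (oa , eb) =
  inj₂ (even+1 b eb , ≤-trans (≤-reflexive (+-comm b 1)) (+-monoˡ-≤ b (odd⇒positive a oa)))
... | inj₂ refl | inj₂ (ea , ob) =
  inj₁ (even+1 a ea , +-monoʳ-≤ a (odd⇒positive b ob))

by-symmetry : ∀ {k} (R : Fin k → Fin k → Set) → (∀ {i j} → R i j → R j i) →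
  (∀ {i j} → toℕ i < toℕ j → R i j) → ∀ {i j} → i ≢ j → R i j
by-symmetry R flip below {i} {j} i≢j with <-cmp (toℕ i) (toℕ j)
... | tri< i<j _ _ = below i<j
... | tri≈ _ i≡j _ = ⊥-elim (i≢j (Fin.toℕ-injective i≡j))
... | tri> _ _ j<i = flip (below j<i)

positions-consecutive : ∀ {a b k} p q r → a ≡ p → b ≡ suc (p + q) → k ≡ p + suc (q + suc r) →
  (b ≡ suc a ⊎ (a ≡ 0 × suc b ≡ k)) ⇔ (q ≡ 0 ⊎ (p ≡ 0 × r ≡ 0))
positions-consecutive p q r refl refl refl = next ⊎-⇔ wrap
  where
  next : suc (p + q) ≡ suc p ⇔ q ≡ 0
  next = mk⇔ (λ e → +-cancelˡ-≡ p q 0 (trans (suc-injective e) (sym (+-identityʳ p))))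
             (λ { refl → cong suc (+-identityʳ p) })
  wrap : (p ≡ 0 × suc (suc (p + q)) ≡ p + suc (q + suc r)) ⇔ (p ≡ 0 × r ≡ 0)
  wrap = mk⇔ (λ { (refl , e) → refl , sym (+-cancelˡ-≡ q 0 r
                   (trans (+-identityʳ q) (suc-injective (trans (suc-injective e) (+-suc q r))))) })
             (λ { (refl , refl) → refl , cong suc (sym (+-comm q 1)) })

pathPairs : ∀ {A : Set} → List A → List (A × A)
pathPairs []           = []
pathPairs (x ∷ [])     = []
pathPairs (x ∷ y ∷ xs) = (x , y) ∷ pathPairs (y ∷ xs)

zip-shift : ∀ {A : Set} (x : A) xs y → zip (x ∷ xs) (xs ++ [ y ]) ≡ pathPairs (x ∷ xs ++ [ y ])
zip-shift x []       y = refl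
zip-shift x (z ∷ xs) y = cong ((x , z) ∷_) (zip-shift z xs y)

pathPairs-++ : ∀ {A : Set} (x : A) xs y ys →
  pathPairs (x ∷ xs ++ y ∷ ys) ≡ pathPairs (x ∷ xs ++ [ y ]) ++ pathPairs (y ∷ ys)
pathPairs-++ x []       y ys = refl
pathPairs-++ x (z ∷ xs) y ys = cong ((x , z) ∷_) (pathPairs-++ z xs y ys)

length≡0⇔[] : ∀ {A : Set} (xs : List A) → length xs ≡ 0 ⇔ xs ≡ []
length≡0⇔[] []      = mk⇔ (λ _ → refl) (λ _ → refl)
length≡0⇔[] (_ ∷ _) = mk⇔ (λ ()) (λ ())

++≡[]⇔ : ∀ {A : Set} (xs ys : List A) → (length ys ≡ 0 × length xs ≡ 0) ⇔ xs ++ ys ≡ []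
++≡[]⇔ xs ys = mk⇔
  (λ (ys0 , xs0) → cong₂ _++_ (Equivalence.to (length≡0⇔[] xs) xs0)
                                (Equivalence.to (length≡0⇔[] ys) ys0))
  (λ e → Equivalence.from (length≡0⇔[] ys) (++-conicalʳ xs ys e) ,
         Equivalence.from (length≡0⇔[] xs) (++-conicalˡ xs ys e))

prefix-shorter : ∀ {A : Set} (xs : List A) y ys → length xs < length (xs ++ y ∷ ys)
prefix-shorter []       y ys = s≤s z≤n
prefix-shorter (x ∷ xs) y ys = s≤s (prefix-shorter xs y ys)

suffix-shorter : ∀ {A : Set} (x : A) xs ys → length ys < length (x ∷ xs ++ ys)
suffix-shorter x xs ys = s≤s (≤-trans (m≤n+m (length ys) (length xs)) (≤-reflexive (sym (length-++ xs))))

arc-shorter : ∀ {A : Set} (Q : List A) w T → T ≢ [] → length (Q ++ [ w ]) < length (Q ++ w ∷ T)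
arc-shorter []      w []      T≢[] = ⊥-elim (T≢[] refl)
arc-shorter []      w (_ ∷ _) _    = s≤s (s≤s z≤n)
arc-shorter (_ ∷ Q) w T       T≢[] = s≤s (arc-shorter Q w T T≢[])

arc⊆ : ∀ {A : Set} (u : A) Q w T → u ∷ Q ++ [ w ] ⊆ u ∷ Q ++ w ∷ T
arc⊆ u Q w T = ∷⁺ʳ u (++⁺ʳ Q (∷⁺ʳ w (λ ())))

cut-at : ∀ {A : Set} (S : List A) (i : Fin (length S)) →
  Σ (List A) λ P → Σ (List A) λ R → S ≡ P ++ lookup S i ∷ R × toℕ i ≡ length P
cut-at (x ∷ xs) Fin.zero    = [] , xs , refl , refl
cut-at (x ∷ xs) (Fin.suc i) with cut-at xs i
... | P , R , e , p = x ∷ P , R , cong (x ∷_) e , cong suc p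

record Cut {A : Set} (S : List A) (i j : Fin (length S)) : Set where
  field
    before between after : List A
    cut   : S ≡ before ++ lookup S i ∷ between ++ lookup S j ∷ after
    pos-i : toℕ i ≡ length before
    pos-j : toℕ j ≡ suc (length before + length between)

  cut-length : length S ≡ length before + suc (length between + suc (length after))
  cut-length = trans (cong length cut)
    (trans (length-++ before) (cong (λ z → length before + suc z) (length-++ between)))

cut-at₂ : ∀ {A : Set} (S : List A) (i j : Fin (length S)) → toℕ i < toℕ j → Cut S i j
cut-at₂ (x ∷ xs) Fin.zero (Fin.suc j) _ with cut-at xs j
... | Q , R , e , p = record
  { before = [] ; between = Q ; after = R ; cut = cong (x ∷_) e ; pos-i = refl ; pos-j = cong suc p }
cut-at₂ (x ∷ xs) (Fin.suc i) (Fin.suc j) i<j = record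
  { before = x ∷ before ; between = between ; after = after
  ; cut = cong (x ∷_) cut ; pos-i = cong suc pos-i ; pos-j = cong suc pos-j }
  where open Cut (cut-at₂ xs i j (s<s⁻¹ i<j))

data Rotation {A : Set} : List A → List A → Set where
  rotate : ∀ P M → Rotation (P ++ M) (M ++ P)

rotation-perm : ∀ {A : Set} {S Z : List A} → Rotation S Z → S ↭ Z
rotation-perm (rotate P M) = ++-comm P M

cut-rotation : ∀ {A : Set} {S : List A} {i j} (c : Cut S i j) →
  Rotation S (lookup S i ∷ Cut.between c ++ lookup S j ∷ Cut.after c ++ Cut.before c)
cut-rotation {S = S} {i} {j} c = subst₂ Rotation (sym cut)
  (cong (lookup S i ∷_) (++-assoc between (lookup S j ∷ after) before))
  (rotate before (lookup S i ∷ between ++ lookup S j ∷ after))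
  where open Cut c

module _ (G : QuadP2) where
  open QuadP2 G

  Vertex : Set
  Vertex = V G

  adj-sym : ∀ {u w} → Adj G u w → Adj G w u
  adj-sym (x , xu , α₀xw) = α₀ x , α₀xw , trans (cong vert (α₀-inv x)) xu

  face-sym : ∀ {u w} → CommonFace G u w → CommonFace G w u
  face-sym (x , y , same , xu , yw) = y , x , sym same , yw , xu

  adj⇒face : ∀ {u w} → Adj G u w → CommonFace G u w
  adj⇒face (x , xu , α₀xw) =
    x , α₀ x , Equivalence.from (face-orbit x (α₀ x)) (step here (Any.here refl)) , xu , α₀xw

  face? : ∀ u w → Dec (CommonFace G u w)
  face? u w = Fin.any? λ x → Fin.any? λ y →
    (face x Fin.≟ face y) ×-dec ((vert x Fin.≟ u) ×-dec (vert y Fin.≟ w))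

  consecutive-sym : ∀ k {i j : Fin k} → Consecutive G k i j → Consecutive G k j i
  consecutive-sym (suc n) = Sum.swap

  consecutive? : ∀ k (i j : Fin k) → Dec (Consecutive G k i j)
  consecutive? (suc n) i j =
    (toℕ j ≟ suc (toℕ i) % suc n) ⊎-dec (toℕ i ≟ suc (toℕ j) % suc n)

  consecutive-ordered : ∀ k (i j : Fin k) → toℕ i < toℕ j →
    Consecutive G k i j ⇔ (toℕ j ≡ suc (toℕ i) ⊎ (toℕ i ≡ 0 × suc (toℕ j) ≡ k))
  consecutive-ordered (suc n) i j i<j = next ⊎-⇔ wrap
    where
    i+1-mod : suc (toℕ i) % suc n ≡ suc (toℕ i)
    i+1-mod = m<n⇒m%n≡m (≤-<-trans i<j (Fin.toℕ<n j))
    next : toℕ j ≡ suc (toℕ i) % suc n ⇔ toℕ j ≡ suc (toℕ i)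
    next = mk⇔ (λ e → trans e i+1-mod) (λ e → trans e (sym i+1-mod))
    wrap : toℕ i ≡ suc (toℕ j) % suc n ⇔ (toℕ i ≡ 0 × suc (toℕ j) ≡ suc n)
    wrap with m≤n⇒m<n∨m≡n (Fin.toℕ<n j)
    ... | inj₁ j+1<k = mk⇔
      (λ e → ⊥-elim (<-irrefl (trans e (m<n⇒m%n≡m j+1<k)) (<-trans i<j (n<1+n (toℕ j)))))
      (λ (_ , e) → ⊥-elim (<-irrefl e j+1<k))
    ... | inj₂ j+1≡k = mk⇔ (λ e → trans e wraps , j+1≡k) (λ (i≡0 , _) → trans i≡0 (sym wraps))
      where
      wraps : suc (toℕ j) % suc n ≡ 0
      wraps = trans (cong (_% suc n) j+1≡k) (n%n≡0 (suc n))

  consecutive-cut : ∀ {S : List Vertex} {i j} → toℕ i < toℕ j → (c : Cut S i j) →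
    Consecutive G (length S) i j ⇔ (Cut.between c ≡ [] ⊎ Cut.after c ++ Cut.before c ≡ [])
  consecutive-cut {S} {i} {j} i<j c = ⇔-trans (consecutive-ordered (length S) i j i<j)
    (⇔-trans (positions-consecutive (length before) (length between) (length after) pos-i pos-j cut-length)
             (length≡0⇔[] between ⊎-⇔ ++≡[]⇔ after before))
    where open Cut c

  adjPair? : (p : Vertex × Vertex) → Dec (Adj G (proj₁ p) (proj₂ p))
  adjPair? p = adj? G (proj₁ p) (proj₂ p)

  adjCount : List (Vertex × Vertex) → ℕ
  adjCount L = length (filter adjPair? L)

  OnFaces : List (Vertex × Vertex) → Set
  OnFaces = All (λ p → CommonFace G (proj₁ p) (proj₂ p))

  adjCount-++ : ∀ L M → adjCount (L ++ M) ≡ adjCount L + adjCount M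
  adjCount-++ L M = trans (cong length (filter-++ adjPair? L M)) (length-++ (filter adjPair? L))

  adjCount-↭ : ∀ {L M} → L ↭ M → adjCount L ≡ adjCount M
  adjCount-↭ L↭M = ↭-length (filter-↭ adjPair? L↭M)

  adjCount-flip : ∀ u w → adjCount [ (u , w) ] ≡ adjCount [ (w , u) ]
  adjCount-flip u w with adj? G u w | adj? G w u
  ... | yes _  | yes _  = refl
  ... | no _   | no _   = refl
  ... | yes uw | no ¬wu = ⊥-elim (¬wu (adj-sym uw))
  ... | no ¬uw | yes wu = ⊥-elim (¬uw (adj-sym wu))

  cyclicPairs-closed : ∀ x xs → cyclicPairs G (x ∷ xs) ≡ pathPairs (x ∷ xs ++ [ x ])
  cyclicPairs-closed x xs = zip-shift x xs x

  cyclicPairs-chord : ∀ u Q w T →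
    cyclicPairs G (u ∷ Q ++ w ∷ T) ≡ pathPairs (u ∷ Q ++ [ w ]) ++ pathPairs (w ∷ T ++ [ u ])
  cyclicPairs-chord u Q w T = trans (cyclicPairs-closed u (Q ++ w ∷ T))
    (trans (cong (λ z → pathPairs (u ∷ z)) (++-assoc Q (w ∷ T) [ u ])) (pathPairs-++ u Q w (T ++ [ u ])))

  cyclicPairs-repeat : ∀ u Q T →
    cyclicPairs G (u ∷ Q ++ u ∷ T) ≡ cyclicPairs G (u ∷ Q) ++ cyclicPairs G (u ∷ T)
  cyclicPairs-repeat u Q T = trans (cyclicPairs-chord u Q u T)
    (sym (cong₂ _++_ (cyclicPairs-closed u Q) (cyclicPairs-closed u T)))

  cyclicPairs-rotate : ∀ {S Z} → Rotation S Z → cyclicPairs G S ↭ cyclicPairs G Z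
  cyclicPairs-rotate (rotate [] M) = ↭-reflexive (cong (cyclicPairs G) (sym (++-identityʳ M)))
  cyclicPairs-rotate (rotate (p ∷ P) []) = ↭-reflexive (cong (cyclicPairs G) (++-identityʳ (p ∷ P)))
  cyclicPairs-rotate (rotate (p ∷ P) (u ∷ M)) = ↭-trans (↭-reflexive (cyclicPairs-chord p P u M))
    (↭-trans (++-comm (pathPairs (p ∷ P ++ [ u ])) (pathPairs (u ∷ M ++ [ p ])))
             (↭-reflexive (sym (cyclicPairs-chord u M p P))))

  rotation-support : ∀ {S Z} → Rotation S Z → IsSupportSet G S → IsSupportSet G Z
  rotation-support r = All-resp-↭ (cyclicPairs-rotate r)

  rotation-order : ∀ {S Z} → Rotation S Z → order G S ≡ order G Z
  rotation-order r = adjCount-↭ (cyclicPairs-rotate r)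

  close-arc : ∀ u Q w → OnFaces (pathPairs (u ∷ Q ++ [ w ])) → CommonFace G w u →
    IsSupportSet G (u ∷ Q ++ [ w ]) ×
    order G (u ∷ Q ++ [ w ]) ≡ adjCount (pathPairs (u ∷ Q ++ [ w ])) + adjCount [ (w , u) ]
  close-arc u Q w walk wu =
    subst OnFaces (sym split) (All.++⁺ walk (wu All.∷ All.[])) ,
    trans (cong adjCount split) (adjCount-++ (pathPairs (u ∷ Q ++ [ w ])) [ (w , u) ])
    where
    split : cyclicPairs G (u ∷ Q ++ [ w ]) ≡ pathPairs (u ∷ Q ++ [ w ]) ++ [ (w , u) ]
    split = cyclicPairs-chord u Q w []

  record Shortening (S : List Vertex) : Set where
    field
      list    : List Vertex
      support : IsSupportSet G list
      odd     : Odd G (order G list)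
      ⊆S      : list ⊆ S
      order≤  : order G list ≤ order G S
      shorter : length list < length S

  rotation-shortening : ∀ {S Z} → Rotation S Z → Shortening Z → Shortening S
  rotation-shortening r sh = record
    { list = list ; support = support ; odd = odd
    ; ⊆S = ⊆-respʳ-↭ (↭-sym (rotation-perm r)) ⊆S
    ; order≤ = ≤-trans order≤ (≤-reflexive (sym (rotation-order r)))
    ; shorter = <-≤-trans shorter (≤-reflexive (sym (↭-length (rotation-perm r)))) }
    where open Shortening sh

  repeat-shortening : ∀ u Q w T → u ≡ w → IsSupportSet G (u ∷ Q ++ w ∷ T) →
    Odd G (order G (u ∷ Q ++ w ∷ T)) → Shortening (u ∷ Q ++ w ∷ T)
  repeat-shortening u Q .u T refl sup odd =
    pick (odd-summand a b (subst (λ k → k % 2 ≡ 1) split-order odd))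
    where
    a b : ℕ
    a = order G (u ∷ Q)
    b = order G (u ∷ T)
    split-order : order G (u ∷ Q ++ u ∷ T) ≡ a + b
    split-order = trans (cong adjCount (cyclicPairs-repeat u Q T))
      (adjCount-++ (cyclicPairs G (u ∷ Q)) (cyclicPairs G (u ∷ T)))
    parts : OnFaces (cyclicPairs G (u ∷ Q) ++ cyclicPairs G (u ∷ T))
    parts = subst OnFaces (cyclicPairs-repeat u Q T) sup
    pick : a % 2 ≡ 1 ⊎ b % 2 ≡ 1 → Shortening (u ∷ Q ++ u ∷ T)
    pick (inj₁ oddQ) = record
      { list = u ∷ Q ; support = All.++⁻ˡ _ parts ; odd = oddQ ; ⊆S = xs⊆xs++ys (u ∷ Q) (u ∷ T)
      ; order≤ = ≤-trans (m≤m+n a b) (≤-reflexive (sym split-order))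
      ; shorter = s≤s (prefix-shorter Q u T) }
    pick (inj₂ oddT) = record
      { list = u ∷ T ; support = All.++⁻ʳ (cyclicPairs G (u ∷ Q)) parts ; odd = oddT
      ; ⊆S = xs⊆ys++xs (u ∷ T) (u ∷ Q)
      ; order≤ = ≤-trans (m≤n+m b a) (≤-reflexive (sym split-order))
      ; shorter = suffix-shorter u Q (u ∷ T) }

  arc-shortening : ∀ u Q w T → T ≢ [] → CommonFace G w u → IsSupportSet G (u ∷ Q ++ w ∷ T) →
    Odd G (order G (u ∷ Q ++ [ w ])) → order G (u ∷ Q ++ [ w ]) ≤ order G (u ∷ Q ++ w ∷ T) →
    Shortening (u ∷ Q ++ w ∷ T)
  arc-shortening u Q w T T≢[] wu sup odd order≤ = record
    { list = u ∷ Q ++ [ w ] ; support = proj₁ (close-arc u Q w walk wu) ; odd = odd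
    ; ⊆S = arc⊆ u Q w T ; order≤ = order≤ ; shorter = s≤s (arc-shorter Q w T T≢[]) }
    where
    walk : OnFaces (pathPairs (u ∷ Q ++ [ w ]))
    walk = All.++⁻ˡ (pathPairs (u ∷ Q ++ [ w ])) (subst OnFaces (cyclicPairs-chord u Q w T) sup)

  -- Face-sharing vertices u, w cutting Z = u Q w T into two arcs with nonempty
  -- interiors give a shortening: close both arcs by the pair u w and keep the
  -- one of odd order.
  chord-shortening : ∀ u Q w T → Q ≢ [] → T ≢ [] → CommonFace G u w →
    IsSupportSet G (u ∷ Q ++ w ∷ T) → Odd G (order G (u ∷ Q ++ w ∷ T)) →
    Shortening (u ∷ Q ++ w ∷ T)
  chord-shortening u Q w T Q≢[] T≢[] uw sup odd =
    pick (odd-choice a b c (subst (λ k → k % 2 ≡ 1) split-order odd) (length-filter adjPair? [ (w , u) ]))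
    where
    X Y : List (Vertex × Vertex)
    X = pathPairs (u ∷ Q ++ [ w ])
    Y = pathPairs (w ∷ T ++ [ u ])
    a b c : ℕ
    a = adjCount X
    b = adjCount Y
    c = adjCount [ (w , u) ]
    split-order : order G (u ∷ Q ++ w ∷ T) ≡ a + b
    split-order = trans (cong adjCount (cyclicPairs-chord u Q w T)) (adjCount-++ X Y)
    walks : OnFaces X × OnFaces Y
    walks = All.++⁻ X (subst OnFaces (cyclicPairs-chord u Q w T) sup)
    order₁ : order G (u ∷ Q ++ [ w ]) ≡ a + c
    order₁ = proj₂ (close-arc u Q w (proj₁ walks) (face-sym uw))
    order₂ : order G (w ∷ T ++ [ u ]) ≡ b + c
    order₂ = trans (proj₂ (close-arc w T u (proj₂ walks) uw)) (cong (b +_) (adjCount-flip u w))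
    turn : Rotation (u ∷ Q ++ w ∷ T) (w ∷ T ++ u ∷ Q)
    turn = rotate (u ∷ Q) (w ∷ T)
    pick : ((a + c) % 2 ≡ 1 × a + c ≤ a + b) ⊎ ((b + c) % 2 ≡ 1 × b + c ≤ a + b) →
           Shortening (u ∷ Q ++ w ∷ T)
    pick (inj₁ (odd₁ , le₁)) = arc-shortening u Q w T T≢[] (face-sym uw) sup
      (subst (λ k → k % 2 ≡ 1) (sym order₁) odd₁) (subst₂ _≤_ (sym order₁) (sym split-order) le₁)
    pick (inj₂ (odd₂ , le₂)) = rotation-shortening turn
      (arc-shortening w T u Q Q≢[] uw (rotation-support turn sup)
        (subst (λ k → k % 2 ≡ 1) (sym order₂) odd₂)
        (subst₂ _≤_ (sym order₂) (trans (sym split-order) (rotation-order turn)) le₂))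

  endpoints-face : ∀ u Q w T → IsSupportSet G (u ∷ Q ++ w ∷ T) → Q ≡ [] ⊎ T ≡ [] → CommonFace G u w
  endpoints-face u .[] w T sup (inj₁ refl) = All.head sup
  endpoints-face u Q w .[] sup (inj₂ refl) = face-sym (All.head
    (All.++⁻ʳ (pathPairs (u ∷ Q ++ [ w ])) (subst OnFaces (cyclicPairs-chord u Q w []) sup)))

  Shortcut : (S : List Vertex) → Fin (length S) → Fin (length S) → Set
  Shortcut S i j = i ≢ j × (lookup S i ≡ lookup S j ⊎
    (¬ Consecutive G (length S) i j × CommonFace G (lookup S i) (lookup S j)))

  shortcut? : ∀ S i j → Dec (Shortcut S i j)
  shortcut? S i j = ¬? (i Fin.≟ j) ×-dec
    ((lookup S i Fin.≟ lookup S j) ⊎-dec (¬? (consecutive? (length S) i j) ×-dec face? _ _))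

  shortcut-sym : ∀ S {i j} → Shortcut S i j → Shortcut S j i
  shortcut-sym S (i≢j , inj₁ same)      = i≢j ∘ sym , inj₁ (sym same)
  shortcut-sym S (i≢j , inj₂ (¬c , uw)) = i≢j ∘ sym , inj₂ (¬c ∘ consecutive-sym (length S) , face-sym uw)

  shortcut⇒shortening : ∀ S → IsSupportSet G S → Odd G (order G S) →
    ∀ {i j} → toℕ i < toℕ j → Shortcut S i j → Shortening S
  shortcut⇒shortening S sup odd {i} {j} i<j (_ , pair) = rotation-shortening r (shorten pair)
    where
    c : Cut S i j
    c = cut-at₂ S i j i<j
    open Cut c
    Z : List Vertex
    Z = lookup S i ∷ between ++ lookup S j ∷ after ++ before
    r : Rotation S Z
    r = cut-rotation c
    supZ : IsSupportSet G Z
    supZ = rotation-support r sup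
    oddZ : Odd G (order G Z)
    oddZ = subst (λ k → k % 2 ≡ 1) (rotation-order r) odd
    shorten : lookup S i ≡ lookup S j ⊎
      (¬ Consecutive G (length S) i j × CommonFace G (lookup S i) (lookup S j)) → Shortening Z
    shorten (inj₁ same) = repeat-shortening _ between _ (after ++ before) same supZ oddZ
    shorten (inj₂ (¬c , uw)) =
      chord-shortening _ between _ (after ++ before) (¬c ∘ from ∘ inj₁) (¬c ∘ from ∘ inj₂) uw supZ oddZ
      where
      from : between ≡ [] ⊎ after ++ before ≡ [] → Consecutive G (length S) i j
      from = Equivalence.from (consecutive-cut i<j c)

  consecutive⇒face : ∀ S → IsSupportSet G S → ∀ {i j} → toℕ i < toℕ j →
    Consecutive G (length S) i j → CommonFace G (lookup S i) (lookup S j)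
  consecutive⇒face S sup {i} {j} i<j cons = endpoints-face _ between _ (after ++ before)
    (rotation-support (cut-rotation c) sup) (Equivalence.to (consecutive-cut i<j c) cons)
    where
    c : Cut S i j
    c = cut-at₂ S i j i<j
    open Cut c

  NoShortcut : List Vertex → Set
  NoShortcut S = ∀ i j → ¬ Shortcut S i j

  Chordless : List Vertex → Set
  Chordless S = (i j : Fin (length S)) → i ≢ j →
    ((Adj G (lookup S i) (lookup S j) ⊎ Opposite G (lookup S i) (lookup S j)) ⇔ Consecutive G (length S) i j)

  no-shortcut⇒unique : ∀ S → NoShortcut S → Unique S
  no-shortcut⇒unique S none =
    subst Unique (tabulate-lookup S) (tabulate⁺ (λ i≢j same → none _ _ (i≢j , inj₁ same)))

  no-shortcut⇒chordless : ∀ S → IsSupportSet G S → NoShortcut S → Chordless S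
  no-shortcut⇒chordless S sup none i j i≢j = mk⇔ to from
    where
    u w : Vertex
    u = lookup S i
    w = lookup S j
    to : Adj G u w ⊎ Opposite G u w → Consecutive G (length S) i j
    to linked with consecutive? (length S) i j
    ... | yes cons = cons
    ... | no ¬cons = ⊥-elim (none i j (i≢j , inj₂ (¬cons , Sum.[ adj⇒face , proj₁ ∘ proj₂ ] linked)))
    onFace : Consecutive G (length S) i j → CommonFace G u w
    onFace = by-symmetry (λ i j → Consecutive G (length S) i j → CommonFace G (lookup S i) (lookup S j))
      (λ f → face-sym ∘ f ∘ consecutive-sym (length S)) (consecutive⇒face S sup) i≢j
    from : Consecutive G (length S) i j → Adj G u w ⊎ Opposite G u w
    from cons with adj? G u w
    ... | yes uw = inj₁ uw
    ... | no ¬uw = inj₂ ((λ same → none i j (i≢j , inj₁ same)) , onFace cons , ¬uw)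

  Reduct : List Vertex → ℕ → Set
  Reduct S o = Σ (List Vertex) λ S′ →
    IsSupportSet G S′ × Odd G (order G S′) × All (_∈ S) S′ ×
    order G S′ ≤ o × Unique S′ × Chordless S′

  reduct-mono : ∀ {S S′ o o′} → S ⊆ S′ → o ≤ o′ → Reduct S o → Reduct S′ o′
  reduct-mono sub o≤o′ (R , sup , odd , inS , order≤ , unique , chordless) =
    R , sup , odd , All.map sub inS , ≤-trans order≤ o≤o′ , unique , chordless

  -- Shorten while a shortcut exists; n bounds the length.
  reduce : ∀ n S → length S ≤ n → IsSupportSet G S → Odd G (order G S) → Reduct S (order G S)
  reduce zero    []      _  _ ()
  reduce zero    (_ ∷ _) () _ _
  reduce (suc n) S len sup odd with Fin.any? (λ i → Fin.any? (λ j → shortcut? S i j))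
  ... | yes (i , j , sc) =
    reduct-mono ⊆S order≤ (reduce n list (s≤s⁻¹ (<-≤-trans shorter len)) support oddList)
    where
    sh : Shortening S
    sh = by-symmetry (λ i j → Shortcut S i j → Shortening S) (λ f → f ∘ shortcut-sym S)
      (shortcut⇒shortening S sup odd) (proj₁ sc) sc
    open Shortening sh renaming (odd to oddList)
  ... | no none = S , sup , odd , All.tabulate id , ≤-refl ,
    no-shortcut⇒unique S noShortcut , no-shortcut⇒chordless S sup noShortcut
    where
    noShortcut : NoShortcut S
    noShortcut i j sc = none (i , j , sc)

lemma2p3 : (G : QuadP2) → NonBipartite G →
    (S : List (V G)) → IsSupportSet G S → Odd G (order G S) →
    Σ (List (V G)) λ S′ →
      IsSupportSet G S′ × Odd G (order G S′) ×
      All (_∈ S) S′ × order G S′ ≤ order G S × Unique S′ ×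
      ((i j : Fin (length S′)) → i ≢ j →
        ((Adj G (lookup S′ i) (lookup S′ j) ⊎ Opposite G (lookup S′ i) (lookup S′ j))
          ⇔ Consecutive G (length S′) i j))
lemma2p3 G _ S sup odd = reduce G (length S) S ≤-refl sup odd
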